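{- Let $\Delta\cup\{\delta\}$ be a set of formulas such that $\Delta$ is $\delta$-saturated in $IvFDE_T$. Define $v_\Delta$ on formulas by: $v_\Delta(\psi)=a$ iff $\theta_a(\psi)\in\Delta$, for $a\in B_T$. Then $v_\Delta$ is a well-defined function, it is a valuation over the Nmatrix $\mathcal M_{IvFDE_T}$, and for every formula $\psi$, $v_\Delta(\psi)\in D$ iff $\psi\in\Delta$.
   Context: Formulas are built from a countable set of propositional variables using binary $\land,\lor,\to$ and unary $\neg,\sim,\square$. Write $\alpha\leftrightarrow\beta$ for $(\alpha\to\beta)\land(\beta\to\alpha)$. Hilbert calculus $IvFDE_T$: the only rule is modus ponens, and the axiom schemas are: - $\varphi\to(\psi\to\varphi)$; - $(\varphi\to(\psi\to\gamma))\to((\varphi\to\psi)\to(\varphi\to\gamma))$; - $\varphi\to(\psi\to(\varphi\land\psi))$; - $(\varphi\land\psi)\to\varphi$; - $(\varphi\land\psi)\to\psi$; - $\varphi\to(\varphi\lor\psi)$; - $\psi\to(\varphi\lor\psi)$; - $(\varphi\to\gamma)\to((\psi\to\gamma)\to((\varphi\lor\psi)\to\gamma))$; - $\neg\neg\varphi\leftrightarrow\varphi$; - $\neg(\varphi\lor\psi)\leftrightarrow(\neg\varphi\land\neg\psi)$; - $\neg(\varphi\land\psi)\leftrightarrow(\neg\varphi\lor\neg\psi)$; - $\neg(\varphi\to\psi)\leftrightarrow(\varphi\land\neg\psi)$; - $\varphi\lor(\varphi\to\psi)$; - $(\sim\psi\to\sim\varphi)\to((\sim\psi\to\varphi)\to\psi)$;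 - $\square(\varphi\to\psi)\to(\square\varphi\to\square\psi)$; - $\square(\varphi\to\psi)\to(\square\sim\psi\to\square\sim\varphi)$; - $\square\sim(\varphi\to\psi)\leftrightarrow(\square\varphi\land\square\sim\psi)$; - $(\square\sim\varphi\lor\square\psi)\to\square(\varphi\to\psi)$; - $\square\varphi\to\varphi$; - $\square\varphi\leftrightarrow\square\sim\sim\varphi$; - $\square(\varphi\land\psi)\leftrightarrow(\square\varphi\land\square\psi)$; - $\square\sim(\varphi\lor\psi)\leftrightarrow\square(\sim\varphi\land\sim\psi)$; - $(\square\sim\varphi\lor\square\sim\psi)\to\square\sim(\varphi\land\psi)$; - $(\square\varphi\lor\square\psi)\to\square(\varphi\lor\psi)$; - $\square\varphi\leftrightarrow\square\sim\neg\varphi$; - $\square\sim\varphi\leftrightarrow\square\sim\neg\neg\varphi$; - $\square\sim(\varphi\land\psi)\to(\square\varphi\to\square\sim\psi)$; - $\square\sim(\varphi\land\psi)\to(\square\psi\to\square\sim\varphi)$; - $\square(\varphi\lor\psi)\to(\square\sim\varphi\to\square\psi)$; - $\square(\varphi\lor\psi)\to(\square\sim\psi\to\square\varphi)$. $\Delta$ is $\delta$-saturated if $\Delta\nvdash\delta$ and $\Delta\cup\{\psi\}\vdash\delta$ for every $\psi\notin\Delta$. Semantics. On $\{0,1\}$ let $\sqcap,\sqcup,\Rightarrow,\sim$ be the Boolean operations. Let $B_T=\{z\in\{0,1\}^4:z_2\le z_1,\ z_1\sqcap z_3=0,\ z_2\sqcap z_4=0,\ z_3\le z_4\}=\{T_0,t_0,t_1,f_0,f_1,F_1\}$,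 where $T_0=(1,1,0,0)$, $t_0=(1,0,0,0)$, $t_1=(1,0,0,1)$, $f_0=(0,0,0,0)$, $f_1=(0,0,0,1)$, $F_1=(0,0,1,1)$. Let $D=\{z:z_1=1\}$. The multioperations of $\mathcal M_{IvFDE_T}$ are: - $z\tilde\land w=\{u\in B_T:u_1=z_1\sqcap w_1,\ u_2=z_2\sqcap w_2,\ u_4=z_4\sqcup w_4,\ z_3\sqcup w_3\le u_3\le(z_2\Rightarrow w_3)\sqcap(w_2\Rightarrow z_3)\}$; - $z\tilde\lor w=\{u:u_1=z_1\sqcup w_1,\ u_3=z_3\sqcap w_3,\ u_4=z_4\sqcap w_4,\ z_2\sqcup w_2\le u_2\le(z_3\Rightarrow w_2)\sqcap(w_3\Rightarrow z_2)\}$; - $z\tilde\to w=\{u:u_1=z_1\Rightarrow w_1,\ u_3=z_2\sqcap w_3,\ u_4=z_1\sqcap w_4,\ z_3\sqcup w_2\le u_2\le(z_2\Rightarrow w_2)\sqcap(w_3\Rightarrow z_3)\}$; - $\tilde\sim z=\{u:u_1=\sim z_1,\ u_2=z_3,\ u_3=z_2,\ z_2\le u_4\le\sim z_3\}$; - $\tilde\neg z=\{(z_4,z_3,z_2,z_1)\}$; - $\tilde\square z=\{u:u_1=z_2\}$. A valuation is a map $v$ from formulas to $B_T$ with $v(\#(\varphi_1,\ldots,\varphi_n))\in\tilde\#(v(\varphi_1),\ldots,v(\varphi_n))$. The formulas $\theta_a$ are defined by: - $\theta_{T_0}(\varphi)=\square\varphi$; - $\theta_{t_1}(\varphi)=\varphi\land\neg\varphi$;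 - $\theta_{t_0}(\varphi)=\varphi\land\sim\neg\varphi\land\sim\square\varphi$; - $\theta_{f_1}(\varphi)=\sim\varphi\land\neg\varphi\land\sim\square\sim\varphi$; - $\theta_{f_0}(\varphi)=\sim\varphi\land\sim\neg\varphi$; - $\theta_{F_1}(\varphi)=\square\sim\varphi$. -}

module Defs where

open import Data.Nat using (ℕ)
open import Data.Bool using (Bool; true; false; _∧_; _∨_; not; _≤_)
open import Data.Sum using (_⊎_)
open import Data.Product using (_×_)
open import Relation.Binary.PropositionalEquality using (_≡_)
open import Relation.Nullary using (¬_)

-- Formulas: variables, binary ∧ ∨ →, unary ¬ (De Morgan negation),
-- ∼ (paraconsistent/classical-like negation), □

infixr 5 _⇒_
infixl 6 _∨ᶠ_
infixl 7 _∧ᶠ_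
infix 8 ¬ᶠ_ ∼_ □_

data Formula : Set where
  var   : ℕ → Formula
  _∧ᶠ_  : Formula → Formula → Formula
  _∨ᶠ_  : Formula → Formula → Formula
  _⇒_   : Formula → Formula → Formula
  ¬ᶠ_   : Formula → Formula
  ∼_    : Formula → Formula
  □_    : Formula → Formula

infix 4 _↔ᶠ_
_↔ᶠ_ : Formula → Formula → Formula
α ↔ᶠ β = (α ⇒ β) ∧ᶠ (β ⇒ α)

data Axiom : Formula → Set where
  K    : ∀ φ ψ → Axiom (φ ⇒ (ψ ⇒ φ))
  S    : ∀ φ ψ γ → Axiom ((φ ⇒ (ψ ⇒ γ)) ⇒ ((φ ⇒ ψ) ⇒ (φ ⇒ γ)))
  ∧I   : ∀ φ ψ → Axiom (φ ⇒ (ψ ⇒ (φ ∧ᶠ ψ)))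
  ∧E₁  : ∀ φ ψ → Axiom ((φ ∧ᶠ ψ) ⇒ φ)
  ∧E₂  : ∀ φ ψ → Axiom ((φ ∧ᶠ ψ) ⇒ ψ)
  ∨I₁  : ∀ φ ψ → Axiom (φ ⇒ (φ ∨ᶠ ψ))
  ∨I₂  : ∀ φ ψ → Axiom (ψ ⇒ (φ ∨ᶠ ψ))
  ∨E   : ∀ φ ψ γ → Axiom ((φ ⇒ γ) ⇒ ((ψ ⇒ γ) ⇒ ((φ ∨ᶠ ψ) ⇒ γ)))
  ¬¬   : ∀ φ → Axiom ((¬ᶠ ¬ᶠ φ) ↔ᶠ φ)
  ¬∨   : ∀ φ ψ → Axiom ((¬ᶠ (φ ∨ᶠ ψ)) ↔ᶠ (¬ᶠ φ ∧ᶠ ¬ᶠ ψ))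
  ¬∧   : ∀ φ ψ → Axiom ((¬ᶠ (φ ∧ᶠ ψ)) ↔ᶠ (¬ᶠ φ ∨ᶠ ¬ᶠ ψ))
  ¬⇒   : ∀ φ ψ → Axiom ((¬ᶠ (φ ⇒ ψ)) ↔ᶠ (φ ∧ᶠ ¬ᶠ ψ))
  PL   : ∀ φ ψ → Axiom (φ ∨ᶠ (φ ⇒ ψ))
  ∼ax  : ∀ φ ψ → Axiom ((∼ ψ ⇒ ∼ φ) ⇒ ((∼ ψ ⇒ φ) ⇒ ψ))
  □1   : ∀ φ ψ → Axiom (□ (φ ⇒ ψ) ⇒ (□ φ ⇒ □ ψ))
  □2   : ∀ φ ψ → Axiom (□ (φ ⇒ ψ) ⇒ (□ ∼ ψ ⇒ □ ∼ φ))
  □3   : ∀ φ ψ → Axiom ((□ ∼ (φ ⇒ ψ)) ↔ᶠ (□ φ ∧ᶠ □ ∼ ψ))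
  □4   : ∀ φ ψ → Axiom ((□ ∼ φ ∨ᶠ □ ψ) ⇒ □ (φ ⇒ ψ))
  □5   : ∀ φ → Axiom (□ φ ⇒ φ)
  □6   : ∀ φ → Axiom ((□ φ) ↔ᶠ (□ ∼ ∼ φ))
  □7   : ∀ φ ψ → Axiom ((□ (φ ∧ᶠ ψ)) ↔ᶠ (□ φ ∧ᶠ □ ψ))
  □8   : ∀ φ ψ → Axiom ((□ ∼ (φ ∨ᶠ ψ)) ↔ᶠ (□ (∼ φ ∧ᶠ ∼ ψ)))
  □9   : ∀ φ ψ → Axiom ((□ ∼ φ ∨ᶠ □ ∼ ψ) ⇒ □ ∼ (φ ∧ᶠ ψ))
  □10  : ∀ φ ψ → Axiom ((□ φ ∨ᶠ □ ψ) ⇒ □ (φ ∨ᶠ ψ))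
  □11  : ∀ φ → Axiom ((□ φ) ↔ᶠ (□ ∼ ¬ᶠ φ))
  □12  : ∀ φ → Axiom ((□ ∼ φ) ↔ᶠ (□ ∼ ¬ᶠ ¬ᶠ φ))
  □13  : ∀ φ ψ → Axiom (□ ∼ (φ ∧ᶠ ψ) ⇒ (□ φ ⇒ □ ∼ ψ))
  □14  : ∀ φ ψ → Axiom (□ ∼ (φ ∧ᶠ ψ) ⇒ (□ ψ ⇒ □ ∼ φ))
  □15  : ∀ φ ψ → Axiom (□ (φ ∨ᶠ ψ) ⇒ (□ ∼ φ ⇒ □ ψ))
  □16  : ∀ φ ψ → Axiom (□ (φ ∨ᶠ ψ) ⇒ (□ ∼ ψ ⇒ □ φ))

FSet : Set₁
FSet = Formula → Set

_∪｛_｝ : FSet → Formula → FSet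
(Γ ∪｛ ψ ｝) χ = Γ χ ⊎ χ ≡ ψ

infix 3 _⊢_
data _⊢_ (Γ : FSet) : Formula → Set where
  hyp : ∀ {φ} → Γ φ → Γ ⊢ φ
  ax  : ∀ {φ} → Axiom φ → Γ ⊢ φ
  mp  : ∀ {φ ψ} → Γ ⊢ φ → Γ ⊢ (φ ⇒ ψ) → Γ ⊢ ψ

Saturated : FSet → Formula → Set
Saturated Δ δ = (¬ (Δ ⊢ δ)) × (∀ ψ → ¬ Δ ψ → (Δ ∪｛ ψ ｝) ⊢ δ)

-- Truth values B_T = {T0, t0, t1, f0, f1, F1} ⊆ {0,1}^4

data BT : Set where
  T₀ t₀ t₁ f₀ f₁ F₁ : BT

π₁ π₂ π₃ π₄ : BT → Bool
π₁ T₀ = true ; π₁ t₀ = true ; π₁ t₁ = true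
π₁ f₀ = false ; π₁ f₁ = false ; π₁ F₁ = false
π₂ T₀ = true ; π₂ t₀ = false ; π₂ t₁ = false
π₂ f₀ = false ; π₂ f₁ = false ; π₂ F₁ = false
π₃ T₀ = false ; π₃ t₀ = false ; π₃ t₁ = false
π₃ f₀ = false ; π₃ f₁ = false ; π₃ F₁ = true
π₄ T₀ = false ; π₄ t₀ = false ; π₄ t₁ = true
π₄ f₀ = false ; π₄ f₁ = true ; π₄ F₁ = true

Designated : BT → Set
Designated z = π₁ z ≡ true

_⇛_ : Bool → Bool → Bool
a ⇛ b = not a ∨ b

-- Multioperations of M_{IvFDE_T}, as membership relations u ∈ op(z, w)

AndM : BT → BT → BT → Set
AndM z w u = (π₁ u ≡ (π₁ z ∧ π₁ w)) × (π₂ u ≡ (π₂ z ∧ π₂ w)) × (π₄ u ≡ (π₄ z ∨ π₄ w))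
           × ((π₃ z ∨ π₃ w) ≤ π₃ u) × (π₃ u ≤ ((π₂ z ⇛ π₃ w) ∧ (π₂ w ⇛ π₃ z)))

OrM : BT → BT → BT → Set
OrM z w u = (π₁ u ≡ (π₁ z ∨ π₁ w)) × (π₃ u ≡ (π₃ z ∧ π₃ w)) × (π₄ u ≡ (π₄ z ∧ π₄ w))
          × ((π₂ z ∨ π₂ w) ≤ π₂ u) × (π₂ u ≤ ((π₃ z ⇛ π₂ w) ∧ (π₃ w ⇛ π₂ z)))

ImpM : BT → BT → BT → Set
ImpM z w u = (π₁ u ≡ (π₁ z ⇛ π₁ w)) × (π₃ u ≡ (π₂ z ∧ π₃ w)) × (π₄ u ≡ (π₁ z ∧ π₄ w))
           × ((π₃ z ∨ π₂ w) ≤ π₂ u) × (π₂ u ≤ ((π₂ z ⇛ π₂ w) ∧ (π₃ w ⇛ π₃ z)))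

TildeM : BT → BT → Set
TildeM z u = (π₁ u ≡ not (π₁ z)) × (π₂ u ≡ π₃ z) × (π₃ u ≡ π₂ z)
           × (π₂ z ≤ π₄ u) × (π₄ u ≤ not (π₃ z))

NegM : BT → BT → Set
NegM z u = (π₁ u ≡ π₄ z) × (π₂ u ≡ π₃ z) × (π₃ u ≡ π₂ z) × (π₄ u ≡ π₁ z)

BoxM : BT → BT → Set
BoxM z u = π₁ u ≡ π₂ z

record IsValuation (v : Formula → BT) : Set where
  field
    v∧ : ∀ φ ψ → AndM (v φ) (v ψ) (v (φ ∧ᶠ ψ))
    v∨ : ∀ φ ψ → OrM (v φ) (v ψ) (v (φ ∨ᶠ ψ))
    v⇒ : ∀ φ ψ → ImpM (v φ) (v ψ) (v (φ ⇒ ψ))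
    v∼ : ∀ φ → TildeM (v φ) (v (∼ φ))
    v¬ : ∀ φ → NegM (v φ) (v (¬ᶠ φ))
    v□ : ∀ φ → BoxM (v φ) (v (□ φ))

θ : BT → Formula → Formula
θ T₀ φ = □ φ
θ t₁ φ = φ ∧ᶠ ¬ᶠ φ
θ t₀ φ = φ ∧ᶠ ∼ ¬ᶠ φ ∧ᶠ ∼ □ φ
θ f₁ φ = ∼ φ ∧ᶠ ¬ᶠ φ ∧ᶠ ∼ □ ∼ φ
θ f₀ φ = ∼ φ ∧ᶠ ∼ ¬ᶠ φ
θ F₁ φ = □ ∼ φ

-- Classically a δ-saturated set Δ is a prime theory: it is deductively closed, contains
-- φ ∧ ψ iff it contains both conjuncts, φ ∨ ψ iff it contains a disjunct, φ ⇒ ψ iff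
-- membership of φ forces that of ψ, and ∼ φ iff it does not contain φ.  Read v_Δ(ψ) as
-- the bit vector recording whether ψ, □ ψ, □ ∼ ψ and ¬ ψ belong to Δ.  The □-axioms say
-- that this vector satisfies the constraints defining B_T, and every clause of the
-- multioperations, read coordinatewise, is one of the axioms read as a statement about
-- membership in Δ.  Finally θ_a(ψ) ∈ Δ says precisely that the vector of ψ is a.
module Submission where

open import Defs
open import Level using (0ℓ)
open import Axiom.ExcludedMiddle using (ExcludedMiddle)
open import Data.Bool using (Bool; true; false; _≤_; f≤t; b≤b)
open import Data.Empty using (⊥-elim)
open import Data.Product using (Σ; _×_; _,_; proj₁; proj₂; uncurry)
open import Data.Sum using (_⊎_; inj₁; inj₂; [_,_])
open import Function using (id; const; _∘_; flip)
open import Function.Bundles using (_⇔_; mk⇔; Equivalence)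
open import Function.Construct.Composition using (_⇔-∘_)
open import Function.Construct.Symmetry using (⇔-sym)
open import Relation.Binary.PropositionalEquality using (_≡_; refl; sym; trans; cong; cong₂)
open import Relation.Nullary using (¬_; Dec; yes; no)
open import Relation.Nullary.Reflects
  using (Reflects; ofʸ; ofⁿ; det; ¬-reflects; _×-reflects_; _⊎-reflects_; _→-reflects_)

open Equivalence using (to; from)

private
  variable
    A B : Set
    a b : Bool
    φ ψ χ α β γ : Formula
    Γ : FSet

reflects-≡ : A ⇔ B → Reflects A a → Reflects B b → a ≡ b
reflects-≡ _ (ofʸ _) (ofʸ _) = refl
reflects-≡ A⇔B (ofʸ x) (ofⁿ ¬y) = ⊥-elim (¬y (to A⇔B x))
reflects-≡ A⇔B (ofⁿ ¬x) (ofʸ y) = ⊥-elim (¬x (from A⇔B y))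
reflects-≡ _ (ofⁿ _) (ofⁿ _) = refl

reflects-≤ : (A → B) → Reflects A a → Reflects B b → a ≤ b
reflects-≤ _ (ofʸ _) (ofʸ _) = b≤b
reflects-≤ A→B (ofʸ x) (ofⁿ ¬y) = ⊥-elim (¬y (A→B x))
reflects-≤ _ (ofⁿ _) (ofʸ _) = f≤t
reflects-≤ _ (ofⁿ _) (ofⁿ _) = b≤b

reflects-≡true⇔ : Reflects A a → (a ≡ true) ⇔ A
reflects-≡true⇔ (ofʸ x) = mk⇔ (const x) (const refl)
reflects-≡true⇔ (ofⁿ ¬x) = mk⇔ (λ ()) (⊥-elim ∘ ¬x)

Bits : Set
Bits = Bool × Bool × Bool × Bool

bits : BT → Bits
bits z = π₁ z , π₂ z , π₃ z , π₄ z

-- Left inverse of bits; bit vectors outside B_T are sent to arbitrary values.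
fromBits : Bits → BT
fromBits (true , true , _ , _) = T₀
fromBits (true , false , _ , true) = t₁
fromBits (true , false , _ , false) = t₀
fromBits (false , _ , true , _) = F₁
fromBits (false , _ , false , true) = f₁
fromBits (false , _ , false , false) = f₀

fromBits-bits : ∀ z → fromBits (bits z) ≡ z
fromBits-bits T₀ = refl
fromBits-bits t₀ = refl
fromBits-bits t₁ = refl
fromBits-bits f₀ = refl
fromBits-bits f₁ = refl
fromBits-bits F₁ = refl

bits-injective : ∀ {z w} → bits z ≡ bits w → z ≡ w
bits-injective {z} {w} eq =
  trans (sym (fromBits-bits z)) (trans (cong fromBits eq) (fromBits-bits w))

Represents : BT → Set → Set → Set → Set → Set
Represents z P₁ P₂ P₃ P₄ =
  Reflects P₁ (π₁ z) × Reflects P₂ (π₂ z) × Reflects P₃ (π₃ z) × Reflects P₄ (π₄ z)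

represents-unique : ∀ {z w P₁ P₂ P₃ P₄} →
  Represents z P₁ P₂ P₃ P₄ → Represents w P₁ P₂ P₃ P₄ → z ≡ w
represents-unique (r₁ , r₂ , r₃ , r₄) (s₁ , s₂ , s₃ , s₄) =
  bits-injective (cong₂ _,_ (det r₁ s₁) (cong₂ _,_ (det r₂ s₂) (cong₂ _,_ (det r₃ s₃) (det r₄ s₄))))

-- The hypotheses are the constraints z₂ ≤ z₁, z₁ ⊓ z₃ = 0, z₂ ⊓ z₄ = 0, z₃ ≤ z₄ defining B_T.
represent : ∀ {P₁ P₂ P₃ P₄} → Dec P₁ → Dec P₂ → Dec P₃ → Dec P₄ →
  (P₂ → P₁) → (P₁ → ¬ P₃) → (P₂ → ¬ P₄) → (P₃ → P₄) →
  Σ BT (λ z → Represents z P₁ P₂ P₃ P₄)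
represent (yes p₁) (yes p₂) (no ¬p₃) (no ¬p₄) _ _ _ _ = T₀ , ofʸ p₁ , ofʸ p₂ , ofⁿ ¬p₃ , ofⁿ ¬p₄
represent (yes p₁) (no ¬p₂) (no ¬p₃) (yes p₄) _ _ _ _ = t₁ , ofʸ p₁ , ofⁿ ¬p₂ , ofⁿ ¬p₃ , ofʸ p₄
represent (yes p₁) (no ¬p₂) (no ¬p₃) (no ¬p₄) _ _ _ _ = t₀ , ofʸ p₁ , ofⁿ ¬p₂ , ofⁿ ¬p₃ , ofⁿ ¬p₄
represent (no ¬p₁) (no ¬p₂) (yes p₃) (yes p₄) _ _ _ _ = F₁ , ofⁿ ¬p₁ , ofⁿ ¬p₂ , ofʸ p₃ , ofʸ p₄
represent (no ¬p₁) (no ¬p₂) (no ¬p₃) (yes p₄) _ _ _ _ = f₁ , ofⁿ ¬p₁ , ofⁿ ¬p₂ , ofⁿ ¬p₃ , ofʸ p₄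
represent (no ¬p₁) (no ¬p₂) (no ¬p₃) (no ¬p₄) _ _ _ _ = f₀ , ofⁿ ¬p₁ , ofⁿ ¬p₂ , ofⁿ ¬p₃ , ofⁿ ¬p₄
represent (no ¬p₁) (yes p₂) _ _ p₂→p₁ _ _ _ = ⊥-elim (¬p₁ (p₂→p₁ p₂))
represent (yes p₁) _ (yes p₃) _ _ p₁#p₃ _ _ = ⊥-elim (p₁#p₃ p₁ p₃)
represent _ (yes p₂) _ (yes p₄) _ _ p₂#p₄ _ = ⊥-elim (p₂#p₄ p₂ p₄)
represent _ _ (yes p₃) (no ¬p₄) _ _ _ p₃→p₄ = ⊥-elim (¬p₄ (p₃→p₄ p₃))

⊢-identity : Γ ⊢ φ ⇒ φ
⊢-identity {φ = φ} = mp (ax (K φ φ)) (mp (ax (K φ (φ ⇒ φ))) (ax (S φ (φ ⇒ φ) φ)))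

deduction : (Γ ∪｛ ψ ｝) ⊢ χ → Γ ⊢ ψ ⇒ χ
deduction (hyp (inj₁ p)) = mp (hyp p) (ax (K _ _))
deduction (hyp (inj₂ refl)) = ⊢-identity
deduction (ax a) = mp (ax a) (ax (K _ _))
deduction (mp d e) = mp (deduction d) (mp (deduction e) (ax (S _ _ _)))

module SaturatedTheory (em : ExcludedMiddle 0ℓ) {Δ : FSet} {δ : Formula} (sat : Saturated Δ δ) where

  ∉-derives-⇒δ : ¬ Δ φ → Δ ⊢ φ ⇒ δ
  ∉-derives-⇒δ {φ} φ∉Δ = deduction (proj₂ sat φ φ∉Δ)

  δ∉Δ : ¬ Δ δ
  δ∉Δ = proj₁ sat ∘ hyp

  deductively-closed : Δ ⊢ φ → Δ φ
  deductively-closed {φ} ⊢φ with em {Δ φ}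
  ... | yes φ∈Δ = φ∈Δ
  ... | no φ∉Δ = ⊥-elim (proj₁ sat (mp ⊢φ (∉-derives-⇒δ φ∉Δ)))

  axiom-∈ : Axiom φ → Δ φ
  axiom-∈ = deductively-closed ∘ ax

  mp-∈ : Δ φ → Δ (φ ⇒ ψ) → Δ ψ
  mp-∈ p q = deductively-closed (mp (hyp p) (hyp q))

  axiom-mp : Axiom (α ⇒ β) → Δ α → Δ β
  axiom-mp a p = mp-∈ p (axiom-∈ a)

  axiom-mp₂ : Axiom (α ⇒ β ⇒ γ) → Δ α → Δ β → Δ γ
  axiom-mp₂ a p q = mp-∈ q (axiom-mp a p)

  ∧-∈ : Δ (φ ∧ᶠ ψ) ⇔ (Δ φ × Δ ψ)
  ∧-∈ {φ} {ψ} =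
    mk⇔ (λ p → axiom-mp (∧E₁ φ ψ) p , axiom-mp (∧E₂ φ ψ) p) (uncurry (axiom-mp₂ (∧I φ ψ)))

  axiom-⇔ : Axiom (α ↔ᶠ β) → Δ α ⇔ Δ β
  axiom-⇔ a with to ∧-∈ (axiom-∈ a)
  ... | α⇒β , β⇒α = mk⇔ (flip mp-∈ α⇒β) (flip mp-∈ β⇒α)

  ∨-∈ : Δ (φ ∨ᶠ ψ) ⇔ (Δ φ ⊎ Δ ψ)
  ∨-∈ {φ} {ψ} = mk⇔ prime [ axiom-mp (∨I₁ φ ψ) , axiom-mp (∨I₂ φ ψ) ]
    where
    prime : Δ (φ ∨ᶠ ψ) → Δ φ ⊎ Δ ψ
    prime p with em {Δ φ} | em {Δ ψ}
    ... | yes φ∈Δ | _ = inj₁ φ∈Δ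
    ... | no _ | yes ψ∈Δ = inj₂ ψ∈Δ
    ... | no φ∉Δ | no ψ∉Δ = ⊥-elim (proj₁ sat (mp (hyp p) φ∨ψ⇒δ))
      where
      φ∨ψ⇒δ : Δ ⊢ φ ∨ᶠ ψ ⇒ δ
      φ∨ψ⇒δ = mp (∉-derives-⇒δ ψ∉Δ) (mp (∉-derives-⇒δ φ∉Δ) (ax (∨E φ ψ δ)))

  ⇒-∈ : Δ (φ ⇒ ψ) ⇔ (Δ φ → Δ ψ)
  ⇒-∈ {φ} {ψ} = mk⇔ (flip mp-∈) closure
    where
    closure : (Δ φ → Δ ψ) → Δ (φ ⇒ ψ)
    closure f with em {Δ φ}
    ... | yes φ∈Δ = axiom-mp (K ψ φ) (f φ∈Δ)
    ... | no φ∉Δ = [ ⊥-elim ∘ φ∉Δ , id ] (to ∨-∈ (axiom-∈ (PL φ ψ)))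

  -- Both directions use the axiom (∼ ψ ⇒ ∼ φ) ⇒ ((∼ ψ ⇒ φ) ⇒ ψ), with ψ := δ and ψ := φ.
  ∼-∈ : Δ (∼ φ) ⇔ (¬ Δ φ)
  ∼-∈ {φ} = mk⇔ exclusive complement
    where
    exclusive : Δ (∼ φ) → ¬ Δ φ
    exclusive ∼φ∈Δ φ∈Δ = δ∉Δ (axiom-mp₂ (∼ax φ δ) (from ⇒-∈ (const ∼φ∈Δ)) (from ⇒-∈ (const φ∈Δ)))

    complement : ¬ Δ φ → Δ (∼ φ)
    complement φ∉Δ with em {Δ (∼ φ)}
    ... | yes ∼φ∈Δ = ∼φ∈Δ
    ... | no ∼φ∉Δ = ⊥-elim (φ∉Δ (axiom-mp₂ (∼ax φ φ) vacuous vacuous))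
      where
      vacuous : ∀ {ψ} → Δ (∼ φ ⇒ ψ)
      vacuous = from ⇒-∈ (⊥-elim ∘ ∼φ∉Δ)

  □-elim : Δ (□ φ) → Δ φ
  □-elim {φ} = axiom-mp (□5 φ)

  □∼-refutes : Δ (□ ∼ φ) → ¬ Δ φ
  □∼-refutes = to ∼-∈ ∘ □-elim

  □-refutes-¬ : Δ (□ φ) → ¬ Δ (¬ᶠ φ)
  □-refutes-¬ {φ} = □∼-refutes ∘ to (axiom-⇔ (□11 φ))

  □¬⇔□∼ : Δ (□ ¬ᶠ φ) ⇔ Δ (□ ∼ φ)
  □¬⇔□∼ {φ} = ⇔-sym (axiom-⇔ (□12 φ)) ⇔-∘ axiom-⇔ (□11 (¬ᶠ φ))

  □∼-elim-¬ : Δ (□ ∼ φ) → Δ (¬ᶠ φ)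
  □∼-elim-¬ = □-elim ∘ from □¬⇔□∼

module CanonicalValuation (em : ExcludedMiddle 0ℓ) {Δ : FSet} {δ : Formula} (sat : Saturated Δ δ) where

  open SaturatedTheory em sat

  Profile : BT → Formula → Set
  Profile z ψ = Represents z (Δ ψ) (Δ (□ ψ)) (Δ (□ ∼ ψ)) (Δ (¬ᶠ ψ))

  profile : ∀ ψ → Σ BT (λ z → Profile z ψ)
  profile ψ = represent em em em em □-elim (flip □∼-refutes) □-refutes-¬ □∼-elim-¬

  vΔ : Formula → BT
  vΔ = proj₁ ∘ profile

  π₁-vΔ : ∀ ψ → Reflects (Δ ψ) (π₁ (vΔ ψ))
  π₁-vΔ ψ = proj₁ (proj₂ (profile ψ))

  π₂-vΔ : ∀ ψ → Reflects (Δ (□ ψ)) (π₂ (vΔ ψ))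
  π₂-vΔ ψ = proj₁ (proj₂ (proj₂ (profile ψ)))

  π₃-vΔ : ∀ ψ → Reflects (Δ (□ ∼ ψ)) (π₃ (vΔ ψ))
  π₃-vΔ ψ = proj₁ (proj₂ (proj₂ (proj₂ (profile ψ))))

  π₄-vΔ : ∀ ψ → Reflects (Δ (¬ᶠ ψ)) (π₄ (vΔ ψ))
  π₄-vΔ ψ = proj₂ (proj₂ (proj₂ (proj₂ (profile ψ))))

  vΔ-≡⇔ : ∀ {ψ z} → (vΔ ψ ≡ z) ⇔ Profile z ψ
  vΔ-≡⇔ {ψ} = mk⇔ (λ { refl → proj₂ (profile ψ) }) (represents-unique (proj₂ (profile ψ)))

  θ-∈⇔ : ∀ z ψ → Δ (θ z ψ) ⇔ Profile z ψ
  θ-∈⇔ T₀ _ = mk⇔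
    (λ p → ofʸ (□-elim p) , ofʸ p , ofⁿ (flip □∼-refutes (□-elim p)) , ofⁿ (□-refutes-¬ p))
    (λ { (_ , ofʸ p , _ , _) → p })
  θ-∈⇔ t₁ _ = mk⇔
    (λ p → let (x , n) = to ∧-∈ p
           in ofʸ x , ofⁿ (flip □-refutes-¬ n) , ofⁿ (flip □∼-refutes x) , ofʸ n)
    (λ { (ofʸ x , _ , _ , ofʸ n) → from ∧-∈ (x , n) })
  θ-∈⇔ t₀ _ = mk⇔
    (λ p → let (x∧∼n , ∼b) = to ∧-∈ p ; (x , ∼n) = to ∧-∈ x∧∼n
           in ofʸ x , ofⁿ (to ∼-∈ ∼b) , ofⁿ (flip □∼-refutes x) , ofⁿ (to ∼-∈ ∼n))
    (λ { (ofʸ x , ofⁿ ¬b , _ , ofⁿ ¬n) → from ∧-∈ (from ∧-∈ (x , from ∼-∈ ¬n) , from ∼-∈ ¬b) })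
  θ-∈⇔ f₁ _ = mk⇔
    (λ p → let (∼x∧n , ∼c) = to ∧-∈ p ; (∼x , n) = to ∧-∈ ∼x∧n
           in ofⁿ (to ∼-∈ ∼x) , ofⁿ (to ∼-∈ ∼x ∘ □-elim) , ofⁿ (to ∼-∈ ∼c) , ofʸ n)
    (λ { (ofⁿ ¬x , _ , ofⁿ ¬c , ofʸ n) → from ∧-∈ (from ∧-∈ (from ∼-∈ ¬x , n) , from ∼-∈ ¬c) })
  θ-∈⇔ f₀ _ = mk⇔
    (λ p → let (∼x , ∼n) = to ∧-∈ p
           in ofⁿ (to ∼-∈ ∼x) , ofⁿ (to ∼-∈ ∼x ∘ □-elim) ,
              ofⁿ (to ∼-∈ ∼n ∘ □∼-elim-¬) , ofⁿ (to ∼-∈ ∼n))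
    (λ { (ofⁿ ¬x , _ , _ , ofⁿ ¬n) → from ∧-∈ (from ∼-∈ ¬x , from ∼-∈ ¬n) })
  θ-∈⇔ F₁ _ = mk⇔
    (λ p → ofⁿ (□∼-refutes p) , ofⁿ (□∼-refutes p ∘ □-elim) , ofʸ p , ofʸ (□∼-elim-¬ p))
    (λ { (_ , _ , ofʸ p , _) → p })

  vΔ-∧ : ∀ φ ψ → AndM (vΔ φ) (vΔ ψ) (vΔ (φ ∧ᶠ ψ))
  vΔ-∧ φ ψ =
    reflects-≡ ∧-∈ (π₁-vΔ _) (π₁-vΔ φ ×-reflects π₁-vΔ ψ) ,
    reflects-≡ (∧-∈ ⇔-∘ axiom-⇔ (□7 φ ψ)) (π₂-vΔ _) (π₂-vΔ φ ×-reflects π₂-vΔ ψ) ,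
    reflects-≡ (∨-∈ ⇔-∘ axiom-⇔ (¬∧ φ ψ)) (π₄-vΔ _) (π₄-vΔ φ ⊎-reflects π₄-vΔ ψ) ,
    reflects-≤ (axiom-mp (□9 φ ψ) ∘ from ∨-∈) (π₃-vΔ φ ⊎-reflects π₃-vΔ ψ) (π₃-vΔ _) ,
    reflects-≤ (λ p → axiom-mp₂ (□13 φ ψ) p , axiom-mp₂ (□14 φ ψ) p) (π₃-vΔ _)
      ((π₂-vΔ φ →-reflects π₃-vΔ ψ) ×-reflects (π₂-vΔ ψ →-reflects π₃-vΔ φ))

  vΔ-∨ : ∀ φ ψ → OrM (vΔ φ) (vΔ ψ) (vΔ (φ ∨ᶠ ψ))
  vΔ-∨ φ ψ =
    reflects-≡ ∨-∈ (π₁-vΔ _) (π₁-vΔ φ ⊎-reflects π₁-vΔ ψ) ,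
    reflects-≡ ((∧-∈ ⇔-∘ axiom-⇔ (□7 (∼ φ) (∼ ψ))) ⇔-∘ axiom-⇔ (□8 φ ψ)) (π₃-vΔ _)
      (π₃-vΔ φ ×-reflects π₃-vΔ ψ) ,
    reflects-≡ (∧-∈ ⇔-∘ axiom-⇔ (¬∨ φ ψ)) (π₄-vΔ _) (π₄-vΔ φ ×-reflects π₄-vΔ ψ) ,
    reflects-≤ (axiom-mp (□10 φ ψ) ∘ from ∨-∈) (π₂-vΔ φ ⊎-reflects π₂-vΔ ψ) (π₂-vΔ _) ,
    reflects-≤ (λ p → axiom-mp₂ (□15 φ ψ) p , axiom-mp₂ (□16 φ ψ) p) (π₂-vΔ _)
      ((π₃-vΔ φ →-reflects π₂-vΔ ψ) ×-reflects (π₃-vΔ ψ →-reflects π₂-vΔ φ))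

  vΔ-⇒ : ∀ φ ψ → ImpM (vΔ φ) (vΔ ψ) (vΔ (φ ⇒ ψ))
  vΔ-⇒ φ ψ =
    reflects-≡ ⇒-∈ (π₁-vΔ _) (π₁-vΔ φ →-reflects π₁-vΔ ψ) ,
    reflects-≡ (∧-∈ ⇔-∘ axiom-⇔ (□3 φ ψ)) (π₃-vΔ _) (π₂-vΔ φ ×-reflects π₃-vΔ ψ) ,
    reflects-≡ (∧-∈ ⇔-∘ axiom-⇔ (¬⇒ φ ψ)) (π₄-vΔ _) (π₁-vΔ φ ×-reflects π₄-vΔ ψ) ,
    reflects-≤ (axiom-mp (□4 φ ψ) ∘ from ∨-∈) (π₃-vΔ φ ⊎-reflects π₂-vΔ ψ) (π₂-vΔ _) ,
    reflects-≤ (λ p → axiom-mp₂ (□1 φ ψ) p , axiom-mp₂ (□2 φ ψ) p) (π₂-vΔ _)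
      ((π₂-vΔ φ →-reflects π₂-vΔ ψ) ×-reflects (π₃-vΔ ψ →-reflects π₃-vΔ φ))

  vΔ-∼ : ∀ φ → TildeM (vΔ φ) (vΔ (∼ φ))
  vΔ-∼ φ =
    reflects-≡ ∼-∈ (π₁-vΔ _) (¬-reflects (π₁-vΔ φ)) ,
    det (π₂-vΔ _) (π₃-vΔ φ) ,
    reflects-≡ (⇔-sym (axiom-⇔ (□6 φ))) (π₃-vΔ _) (π₂-vΔ φ) ,
    reflects-≤ (□∼-elim-¬ ∘ to (axiom-⇔ (□6 φ))) (π₂-vΔ φ) (π₄-vΔ _) ,
    reflects-≤ (flip □-refutes-¬) (π₄-vΔ _) (¬-reflects (π₃-vΔ φ))

  vΔ-¬ : ∀ φ → NegM (vΔ φ) (vΔ (¬ᶠ φ))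
  vΔ-¬ φ =
    det (π₁-vΔ _) (π₄-vΔ φ) ,
    reflects-≡ □¬⇔□∼ (π₂-vΔ _) (π₃-vΔ φ) ,
    reflects-≡ (⇔-sym (axiom-⇔ (□11 φ))) (π₃-vΔ _) (π₂-vΔ φ) ,
    reflects-≡ (axiom-⇔ (¬¬ φ)) (π₄-vΔ _) (π₁-vΔ φ)

  vΔ-□ : ∀ φ → BoxM (vΔ φ) (vΔ (□ φ))
  vΔ-□ φ = det (π₁-vΔ _) (π₂-vΔ φ)

  vΔ-isValuation : IsValuation vΔ
  vΔ-isValuation = record { v∧ = vΔ-∧ ; v∨ = vΔ-∨ ; v⇒ = vΔ-⇒ ; v∼ = vΔ-∼ ; v¬ = vΔ-¬ ; v□ = vΔ-□ }

mainTheorem9 : ExcludedMiddle 0ℓ → (Δ : FSet) (δ : Formula) → Saturated Δ δ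
    → Σ (Formula → BT) (λ v →
    (∀ ψ a → (v ψ ≡ a) ⇔ Δ (θ a ψ))
    × IsValuation v
    × (∀ ψ → Designated (v ψ) ⇔ Δ ψ))
mainTheorem9 em Δ δ sat =
  vΔ ,
  (λ ψ z → ⇔-sym (θ-∈⇔ z ψ) ⇔-∘ vΔ-≡⇔) ,
  vΔ-isValuation ,
  (λ ψ → reflects-≡true⇔ (π₁-vΔ ψ))
  where open CanonicalValuation em sat
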